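{- Let $L=J(P)$ be a finite distributive lattice, of rank $m=|P|$, and let $\eta=(\eta(0),\eta(1),\ldots,\eta(m))$ be a cell of $\mathrm{Hom}(L)=\mathrm{Hom}(C_m,L)$. Then $|\eta(j)|\in\{1,2\}$ for all $j$. Furthermore, if $|\eta(j)|=2$, then $|\eta(j-1)|=1$ when $j\ge 1$ and $|\eta(j+1)|=1$ when $j\le m-1$. Hence $\mathrm{Hom}(L)$ is a cubical complex.
   Context: For a finite poset $P$, $J(P)$ is the lattice of lower order ideals of $P$ ordered by inclusion. $C_m$ denotes the chain $0<1<\cdots<m$. For finite posets $A,B$, $\mathrm{Hom}(A,B)$ is the subcomplex of the product of simplices $\prod_{a\in A}\Delta_B$ whose cells are tuples $(X_a)_{a\in A}$ of nonempty subsets of $B$ such that every map $\eta:A\to B$ with $\eta(a)\in X_a$ for all $a$ is strictly order-preserving; the cell $(X_a)$ is the product of simplices $\Delta_{X_a}$. For a graded poset $L$ of rank $m$, $\mathrm{Hom}(L):=\mathrm{Hom}(C_m,L)$; its vertices are the maximal chains of $L$. A cell of $\mathrm{Hom}(C_m,L)$ is written $\eta=(\eta(0),\ldots,\eta(m))$ with $\eta(j)\subseteq L$. -}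

module Defs where

open import Level using (Level)
open import Data.Nat using (ℕ; suc; _+_)
open import Data.Fin using (Fin; toℕ; _<_)
open import Data.Fin.Subset using (Subset; _∈_; _⊂_)
open import Data.List using (List; length)
open import Data.List.Membership.Propositional renaming (_∈_ to _∈ₗ_)
open import Data.List.Relation.Unary.All using (All)
open import Data.List.Relation.Unary.Unique.Propositional using (Unique)
open import Data.Product using (_×_)
open import Relation.Binary using (Rel)
open import Relation.Binary.PropositionalEquality using (_≡_)

-- A finite poset P is given by a carrier Fin n and a partial order _≼_ on it
-- (IsPartialOrder _≡_ _≼_ from the library).  Elements of J(P) are lower order
-- ideals: subsets I ⊆ Fin n that are down-closed.
IsOrderIdeal : ∀ {ℓ} {n : ℕ} → Rel (Fin n) ℓ → Subset n → Set ℓ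
IsOrderIdeal {n = n} _≼_ I = ∀ (x y : Fin n) → y ≼ x → x ∈ I → y ∈ I

-- A finite set of elements of J(P): a duplicate-free list of order ideals.
-- Its cardinality is the length of the list.
record IdealSet {ℓ} {n : ℕ} (_≼_ : Rel (Fin n) ℓ) : Set ℓ where
  constructor mkIdealSet
  field
    elems    : List (Subset n)
    distinct : Unique elems
    ideals   : All (IsOrderIdeal _≼_) elems

open IdealSet public

card : ∀ {ℓ} {n : ℕ} {_≼_ : Rel (Fin n) ℓ} → IdealSet _≼_ → ℕ
card X = length (elems X)

-- A cell of Hom(C_k, J(P)) (chain C_k = 0 < 1 < ... < k, i.e. Fin (suc k)):
-- a tuple (X_0,...,X_k) of nonempty subsets of J(P) such that every choice
-- function f with f j ∈ X_j is strictly order-preserving (i < j ⇒ f i ⊊ f j;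
-- the order on J(P) is inclusion).
IsCell : ∀ {ℓ} {n : ℕ} (_≼_ : Rel (Fin n) ℓ) (k : ℕ) →
         (Fin (suc k) → IdealSet _≼_) → Set
IsCell {n = n} _≼_ k X =
  (∀ j → 1 Data.Nat.≤ card (X j)) ×
  (∀ (f : Fin (suc k) → Subset n) → (∀ j → f j ∈ₗ elems (X j)) →
     ∀ i j → i < j → f i ⊂ f j)

module Submission where

-- Every element of J(P) is a subset of P, ordered by inclusion,
-- and the argument only uses the Boolean lattice of subsets of P (their
-- cardinalities, intersections and unions).
--
-- 1. A chain h 0 < h 1 < ... < h n of naturals bounded by n is h j = j.
--    Applied to the cardinalities along any choice function of the cell, this
--    shows that every set in position j of the cell has exactly j elements.
-- 2. Two distinct j-sets a, b: any (j-1)-set below both is a ∩ b, and any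
--    (j+1)-set above both is a ∪ b.
-- 3. Hence a position j next to a position with two sets a ≠ b holds only one
--    set (namely a ∩ b or a ∪ b); and a position cannot hold three distinct
--    sets a, b, e: at j = 0 or j = n there is only one j-set, and otherwise,
--    with C below and D above, C = a ∩ e = b ∩ e and D = a ∪ b force e ⊆ C,
--    which is too large.
-- 4. Turning these statements about members into statements about the
--    lengths of duplicate-free lists gives the theorem.

open import Defs
open import Level using (Level)
open import Data.Nat using (ℕ; suc; _+_)
open import Data.Fin using (Fin; toℕ)
open import Data.Product using (_×_)
open import Data.Sum using (_⊎_)
open import Relation.Binary using (Rel; IsPartialOrder)
open import Relation.Binary.PropositionalEquality using (_≡_)

open import Data.Nat using (z≤n; s≤s; s≤s⁻¹; _≤_; _<_; _≟_)
open import Data.Nat.Properties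
  using (≤-refl; ≤-trans; ≤-antisym; ≤-reflexive; ≤∧≢⇒<; <-irrefl; <⇒≱;
         suc-injective; +-monoˡ-≤; +-monoʳ-≤; +-cancelʳ-≤; +-comm)
open import Data.Fin using (zero; suc; inject₁; fromℕ; lower₁)
open import Data.Fin.Properties using (toℕ-inject₁; toℕ-fromℕ; toℕ-lower₁) renaming (_≟_ to _≟ᶠ_)
open import Data.Fin.Induction using (<-weakInduction; >-weakInduction)
open import Data.Fin.Subset using (Subset; _⊆_; _⊂_; _∩_; _∪_; ∣_∣; inside; outside) renaming (_∈_ to _∈ˢ_)
open import Data.Fin.Subset.Properties
  using (drop-∷-⊆; p⊆q⇒∣p∣≤∣q∣; p⊂q⇒∣p∣<∣q∣; ∣p∣≤n; ⊥⊆; ∣⊥∣≡0; ∣p∣≡n⇒p≡⊤;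
         p∩q⊆p; p∩q⊆q; x∈p∩q⁺; p⊆p∪q; q⊆p∪q; x∈p∪q⁻)
open import Data.Vec.Base using (_∷_; []) renaming (here to first)
open import Data.Vec.Functional using (updateAt)
open import Data.Vec.Functional.Properties using (updateAt-updates; updateAt-minimal)
open import Data.List using (List; _∷_; []; length)
open import Data.List.Membership.Propositional renaming (_∈_ to _∈ₗ_)
open import Data.List.Relation.Unary.Any using (here; there)
open import Data.List.Relation.Unary.AllPairs using (_∷_)
open import Data.List.Relation.Unary.All using (_∷_)
open import Data.List.Relation.Unary.Unique.Propositional using (Unique)
open import Data.Product using (Σ; _,_; proj₁; proj₂)
open import Data.Sum using (inj₁; inj₂)
open import Data.Empty using (⊥-elim) renaming (⊥ to Empty)
open import Function using (const)
open import Relation.Nullary using (yes; no)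
open import Relation.Binary.PropositionalEquality using (refl; sym; trans; cong; subst; subst₂; _≢_)

-- A strictly increasing sequence h 0 < ... < h n with h n ≤ n must be the
-- identity; this pins down the size of every set in a cell.
strict-chain-is-identity : ∀ {n} (h : Fin (suc n) → ℕ) →
  (∀ i → h (inject₁ i) < h (suc i)) → h (fromℕ n) ≤ n → ∀ j → h j ≡ toℕ j
strict-chain-is-identity {n} h increasing top≤n j = ≤-antisym (upper j) (lower j)
  where
  lower : ∀ j → toℕ j ≤ h j
  lower = <-weakInduction (λ j → toℕ j ≤ h j) z≤n λ i ih →
    ≤-trans (s≤s (subst (_≤ h (inject₁ i)) (toℕ-inject₁ i) ih)) (increasing i)

  -- counting steps downwards from position n: h j + (n - j) ≤ h n
  gap : ∀ j → h j + n ≤ toℕ j + h (fromℕ n)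
  gap = >-weakInduction (λ j → h j + n ≤ toℕ j + h (fromℕ n))
    (≤-reflexive (trans (+-comm (h (fromℕ n)) n) (cong (_+ h (fromℕ n)) (sym (toℕ-fromℕ n))))) λ i ih →
      subst (λ t → h (inject₁ i) + n ≤ t + h (fromℕ n)) (sym (toℕ-inject₁ i))
        (s≤s⁻¹ (≤-trans (+-monoˡ-≤ n (increasing i)) ih))

  upper : ∀ j → h j ≤ toℕ j
  upper j = +-cancelʳ-≤ n (h j) (toℕ j) (≤-trans (gap j) (+-monoʳ-≤ (toℕ j) top≤n))

⊆-equal-size⇒≡ : ∀ {m} {p q : Subset m} → p ⊆ q → ∣ p ∣ ≡ ∣ q ∣ → p ≡ q
⊆-equal-size⇒≡ {p = []} {[]} _ _ = refl
⊆-equal-size⇒≡ {p = outside ∷ p} {outside ∷ q} p⊆q eq =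
  cong (outside ∷_) (⊆-equal-size⇒≡ (drop-∷-⊆ p⊆q) eq)
⊆-equal-size⇒≡ {p = outside ∷ p} {inside ∷ q} p⊆q eq =
  ⊥-elim (<-irrefl refl (subst (_≤ ∣ q ∣) eq (p⊆q⇒∣p∣≤∣q∣ (drop-∷-⊆ p⊆q))))
⊆-equal-size⇒≡ {p = inside ∷ p} {outside ∷ q} p⊆q eq with () ← p⊆q first
⊆-equal-size⇒≡ {p = inside ∷ p} {inside ∷ q} p⊆q eq =
  cong (inside ∷_) (⊆-equal-size⇒≡ (drop-∷-⊆ p⊆q) (suc-injective eq))

⊆-≢⇒smaller : ∀ {m} {p q : Subset m} → p ⊆ q → p ≢ q → ∣ p ∣ < ∣ q ∣
⊆-≢⇒smaller p⊆q p≢q = ≤∧≢⇒< (p⊆q⇒∣p∣≤∣q∣ p⊆q) (λ eq → p≢q (⊆-equal-size⇒≡ p⊆q eq))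

lower-cover-is-meet : ∀ {m} {a b c : Subset m} → a ≢ b → ∣ a ∣ ≡ ∣ b ∣ →
  c ⊆ a → c ⊆ b → suc ∣ c ∣ ≡ ∣ a ∣ → c ≡ a ∩ b
lower-cover-is-meet {a = a} {b} {c} a≢b ∣a∣≡∣b∣ c⊆a c⊆b ∣c∣+1≡∣a∣ =
  ⊆-equal-size⇒≡ c⊆a∩b (≤-antisym (p⊆q⇒∣p∣≤∣q∣ c⊆a∩b) ∣a∩b∣≤∣c∣)
  where
  c⊆a∩b : c ⊆ a ∩ b
  c⊆a∩b x∈c = x∈p∩q⁺ (c⊆a x∈c , c⊆b x∈c)
  -- a ∩ b = a would give a ⊆ b, hence a = b by size
  a∩b≢a : a ∩ b ≢ a
  a∩b≢a eq = a≢b (⊆-equal-size⇒≡ (subst (_⊆ b) eq (p∩q⊆q a b)) ∣a∣≡∣b∣)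
  ∣a∩b∣≤∣c∣ : ∣ a ∩ b ∣ ≤ ∣ c ∣
  ∣a∩b∣≤∣c∣ = s≤s⁻¹ (subst (suc ∣ a ∩ b ∣ ≤_) (sym ∣c∣+1≡∣a∣)
                      (⊆-≢⇒smaller (p∩q⊆p a b) a∩b≢a))

upper-cover-is-join : ∀ {m} {a b d : Subset m} → a ≢ b → ∣ a ∣ ≡ ∣ b ∣ →
  a ⊆ d → b ⊆ d → ∣ d ∣ ≡ suc ∣ a ∣ → d ≡ a ∪ b
upper-cover-is-join {a = a} {b} {d} a≢b ∣a∣≡∣b∣ a⊆d b⊆d ∣d∣≡∣a∣+1 =
  sym (⊆-equal-size⇒≡ a∪b⊆d (≤-antisym (p⊆q⇒∣p∣≤∣q∣ a∪b⊆d) ∣d∣≤∣a∪b∣))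
  where
  a∪b⊆d : a ∪ b ⊆ d
  a∪b⊆d x∈a∪b with x∈p∪q⁻ a b x∈a∪b
  ... | inj₁ x∈a = a⊆d x∈a
  ... | inj₂ x∈b = b⊆d x∈b
  -- a = a ∪ b would give b ⊆ a, hence b = a by size
  a≢a∪b : a ≢ a ∪ b
  a≢a∪b eq = a≢b (sym (⊆-equal-size⇒≡ (subst (b ⊆_) (sym eq) (q⊆p∪q a b)) (sym ∣a∣≡∣b∣)))
  ∣d∣≤∣a∪b∣ : ∣ d ∣ ≤ ∣ a ∪ b ∣
  ∣d∣≤∣a∪b∣ = subst (_≤ ∣ a ∪ b ∣) (sym ∣d∣≡∣a∣+1) (⊆-≢⇒smaller (p⊆p∪q b) a≢a∪b)

equal-size-zero⇒≡ : ∀ {m} {a b : Subset m} → ∣ a ∣ ≡ 0 → ∣ b ∣ ≡ 0 → a ≡ b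
equal-size-zero⇒≡ {m} ∣a∣≡0 ∣b∣≡0 =
  trans (sym (⊆-equal-size⇒≡ ⊥⊆ (trans (∣⊥∣≡0 m) (sym ∣a∣≡0))))
        (⊆-equal-size⇒≡ ⊥⊆ (trans (∣⊥∣≡0 m) (sym ∣b∣≡0)))

equal-size-full⇒≡ : ∀ {m} {a b : Subset m} → ∣ a ∣ ≡ m → ∣ b ∣ ≡ m → a ≡ b
equal-size-full⇒≡ ∣a∣≡m ∣b∣≡m = trans (∣p∣≡n⇒p≡⊤ ∣a∣≡m) (sym (∣p∣≡n⇒p≡⊤ ∣b∣≡m))

module _ {A : Set} where

  nonempty⇒member : (xs : List A) → 1 ≤ length xs → Σ A (_∈ₗ xs)
  nonempty⇒member (x ∷ _) _ = x , here refl

  constant⇒length≤1 : ∀ {xs : List A} (c : A) → Unique xs →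
    (∀ {x} → x ∈ₗ xs → x ≡ c) → length xs ≤ 1
  constant⇒length≤1 {[]} c _ _ = z≤n
  constant⇒length≤1 {_ ∷ []} c _ _ = ≤-refl
  constant⇒length≤1 {x ∷ y ∷ _} c ((x≢y ∷ _) ∷ _) all≡c =
    ⊥-elim (x≢y (trans (all≡c (here refl)) (sym (all≡c (there (here refl))))))

  ThreeDistinct : List A → Set
  ThreeDistinct xs = Σ A λ a → Σ A λ b → Σ A λ e →
    a ∈ₗ xs × b ∈ₗ xs × e ∈ₗ xs × a ≢ b × a ≢ e × b ≢ e

  no-three⇒length≤2 : ∀ {xs : List A} → Unique xs → (ThreeDistinct xs → Empty) → length xs ≤ 2
  no-three⇒length≤2 {[]} _ _ = z≤n
  no-three⇒length≤2 {_ ∷ []} _ _ = s≤s z≤n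
  no-three⇒length≤2 {_ ∷ _ ∷ []} _ _ = ≤-refl
  no-three⇒length≤2 {a ∷ b ∷ e ∷ _} ((a≢b ∷ a≢e ∷ _) ∷ (b≢e ∷ _) ∷ _) no-three =
    ⊥-elim (no-three (a , b , e , here refl , there (here refl) , there (there (here refl)) ,
                      a≢b , a≢e , b≢e))

  length≡2⇒two-distinct : ∀ {xs : List A} → Unique xs → length xs ≡ 2 →
    Σ A λ a → Σ A λ b → a ∈ₗ xs × b ∈ₗ xs × a ≢ b
  length≡2⇒two-distinct {a ∷ b ∷ []} ((a≢b ∷ _) ∷ _) _ = a , b , here refl , there (here refl) , a≢b

one-or-two : ∀ {l} → 1 ≤ l → l ≤ 2 → l ≡ 1 ⊎ l ≡ 2
one-or-two (s≤s z≤n) (s≤s z≤n) = inj₁ refl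
one-or-two (s≤s z≤n) (s≤s (s≤s z≤n)) = inj₂ refl

zero-or-successor : ∀ {n} (j : Fin (suc n)) → toℕ j ≡ 0 ⊎ Σ (Fin (suc n)) λ i → suc (toℕ i) ≡ toℕ j
zero-or-successor zero = inj₁ refl
zero-or-successor (suc i) = inj₂ (inject₁ i , cong suc (toℕ-inject₁ i))

top-or-predecessor : ∀ {n} (j : Fin (suc n)) → toℕ j ≡ n ⊎ Σ (Fin (suc n)) λ k → suc (toℕ j) ≡ toℕ k
top-or-predecessor {n} j with n ≟ toℕ j
... | yes n≡j = inj₁ (sym n≡j)
... | no n≢j = inj₂ (suc (lower₁ j n≢j) , cong suc (sym (toℕ-lower₁ j n≢j)))

module CellStructure {ℓ} {n : ℕ} {_≼_ : Rel (Fin n) ℓ}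
                     (X : Fin (suc n) → IdealSet _≼_) (cell : IsCell _≼_ n X) where

  _∈X_ : Subset n → Fin (suc n) → Set
  a ∈X j = a ∈ₗ elems (X j)

  Section : (Fin (suc n) → Subset n) → Set
  Section f = ∀ j → f j ∈X j

  section-increasing : ∀ {f} → Section f → ∀ i j → toℕ i < toℕ j → f i ⊂ f j
  section-increasing {f} = proj₂ cell f

  some-section : Fin (suc n) → Subset n
  some-section j = proj₁ (nonempty⇒member (elems (X j)) (proj₁ cell j))

  some-section-is-section : Section some-section
  some-section-is-section j = proj₂ (nonempty⇒member (elems (X j)) (proj₁ cell j))

  update-section : ∀ {f} → Section f → ∀ {a} i → a ∈X i → Section (updateAt f i (const a))
  update-section {f} f-section {a} i a∈Xi k with k ≟ᶠ i
  ... | yes refl = subst (_∈X k) (sym (updateAt-updates k f)) a∈Xi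
  ... | no k≢i = subst (_∈X k) (sym (updateAt-minimal k i f k≢i)) (f-section k)

  strictly-nested : ∀ {i j a b} → a ∈X i → b ∈X j → toℕ i < toℕ j → a ⊂ b
  strictly-nested {i} {j} {a} {b} a∈Xi b∈Xj i<j =
    subst₂ _⊂_ g[i]≡a g[j]≡b (section-increasing g-section i j i<j)
    where
    g : Fin (suc n) → Subset n
    g = updateAt (updateAt some-section i (const a)) j (const b)
    g-section : Section g
    g-section = update-section (update-section some-section-is-section i a∈Xi) j b∈Xj
    g[i]≡a : g i ≡ a
    g[i]≡a = trans (updateAt-minimal i j _ (λ { refl → <-irrefl refl i<j }))
                   (updateAt-updates i some-section)
    g[j]≡b : g j ≡ b
    g[j]≡b = updateAt-updates j _

  nested : ∀ {i j a b} → a ∈X i → b ∈X j → suc (toℕ i) ≡ toℕ j → a ⊆ b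
  nested a∈Xi b∈Xj i⋖j = proj₁ (strictly-nested a∈Xi b∈Xj (≤-reflexive i⋖j))

  rank : ∀ {j a} → a ∈X j → ∣ a ∣ ≡ toℕ j
  rank {j} {a} a∈Xj =
    subst (λ s → ∣ s ∣ ≡ toℕ j) (updateAt-updates j some-section)
      (strict-chain-is-identity (λ k → ∣ g k ∣) increasing (∣p∣≤n (g (fromℕ n))) j)
    where
    g : Fin (suc n) → Subset n
    g = updateAt some-section j (const a)
    increasing : ∀ i → ∣ g (inject₁ i) ∣ < ∣ g (suc i) ∣
    increasing i = p⊂q⇒∣p∣<∣q∣ (section-increasing (update-section some-section-is-section j a∈Xj)
                                  (inject₁ i) (suc i) (s≤s (≤-reflexive (toℕ-inject₁ i))))

  below-two-is-meet : ∀ {i j a b c} → a ≢ b → a ∈X j → b ∈X j →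
    suc (toℕ i) ≡ toℕ j → c ∈X i → c ≡ a ∩ b
  below-two-is-meet a≢b a∈Xj b∈Xj i⋖j c∈Xi =
    lower-cover-is-meet a≢b (trans (rank a∈Xj) (sym (rank b∈Xj)))
      (nested c∈Xi a∈Xj i⋖j) (nested c∈Xi b∈Xj i⋖j)
      (trans (cong suc (rank c∈Xi)) (trans i⋖j (sym (rank a∈Xj))))

  above-two-is-join : ∀ {j k a b d} → a ≢ b → a ∈X j → b ∈X j →
    suc (toℕ j) ≡ toℕ k → d ∈X k → d ≡ a ∪ b
  above-two-is-join a≢b a∈Xj b∈Xj j⋖k d∈Xk =
    upper-cover-is-join a≢b (trans (rank a∈Xj) (sym (rank b∈Xj)))
      (nested a∈Xj d∈Xk j⋖k) (nested b∈Xj d∈Xk j⋖k)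
      (trans (rank d∈Xk) (trans (sym j⋖k) (cong suc (sym (rank a∈Xj)))))

  no-three-distinct : ∀ j → ThreeDistinct (elems (X j)) → Empty
  no-three-distinct j (a , b , e , a∈Xj , b∈Xj , e∈Xj , a≢b , a≢e , b≢e)
    with zero-or-successor j | top-or-predecessor j
  ... | inj₁ j≡0 | _ = a≢b (equal-size-zero⇒≡ (trans (rank a∈Xj) j≡0) (trans (rank b∈Xj) j≡0))
  ... | inj₂ _ | inj₁ j≡n = a≢b (equal-size-full⇒≡ (trans (rank a∈Xj) j≡n) (trans (rank b∈Xj) j≡n))
  ... | inj₂ (i , i⋖j) | inj₂ (k , j⋖k) = <⇒≱ ∣C∣<∣e∣ (p⊆q⇒∣p∣≤∣q∣ e⊆C)
    where
    C : Subset n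
    C = some-section i
    C∈Xi : C ∈X i
    C∈Xi = some-section-is-section i
    D : Subset n
    D = some-section k
    D∈Xk : D ∈X k
    D∈Xk = some-section-is-section k
    e⊆a∪b : e ⊆ a ∪ b
    e⊆a∪b x∈e = subst (_ ∈ˢ_) (above-two-is-join a≢b a∈Xj b∈Xj j⋖k D∈Xk) (nested e∈Xj D∈Xk j⋖k x∈e)
    -- each half of e ⊆ a ∪ b lies in a ∩ e = C or in b ∩ e = C
    e⊆C : e ⊆ C
    e⊆C x∈e with x∈p∪q⁻ a b (e⊆a∪b x∈e)
    ... | inj₁ x∈a = subst (_ ∈ˢ_) (sym (below-two-is-meet a≢e a∈Xj e∈Xj i⋖j C∈Xi)) (x∈p∩q⁺ (x∈a , x∈e))
    ... | inj₂ x∈b = subst (_ ∈ˢ_) (sym (below-two-is-meet b≢e b∈Xj e∈Xj i⋖j C∈Xi)) (x∈p∩q⁺ (x∈b , x∈e))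
    ∣C∣<∣e∣ : ∣ C ∣ < ∣ e ∣
    ∣C∣<∣e∣ = ≤-reflexive (trans (cong suc (rank C∈Xi)) (trans i⋖j (sym (rank e∈Xj))))

  singleton : ∀ j → card (X j) ≤ 1 → card (X j) ≡ 1
  singleton j ≤1 = ≤-antisym ≤1 (proj₁ cell j)

theorem4p3 : ∀ {ℓ} (n : ℕ) (_≼_ : Rel (Fin n) ℓ) → IsPartialOrder _≡_ _≼_ →
    (X : Fin (suc n) → IdealSet _≼_) → IsCell _≼_ n X →
    (∀ j → card (X j) ≡ 1 ⊎ card (X j) ≡ 2) ×
    (∀ j → card (X j) ≡ 2 →
      (∀ i → suc (toℕ i) ≡ toℕ j → card (X i) ≡ 1) ×
      (∀ k → suc (toℕ j) ≡ toℕ k → card (X k) ≡ 1))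
theorem4p3 n _≼_ _ X cell = one-or-two-sets , neighbours-of-two-are-single
  where
  open CellStructure X cell

  one-or-two-sets : ∀ j → card (X j) ≡ 1 ⊎ card (X j) ≡ 2
  one-or-two-sets j =
    one-or-two (proj₁ cell j) (no-three⇒length≤2 (distinct (X j)) (no-three-distinct j))

  neighbours-of-two-are-single : ∀ j → card (X j) ≡ 2 →
    (∀ i → suc (toℕ i) ≡ toℕ j → card (X i) ≡ 1) ×
    (∀ k → suc (toℕ j) ≡ toℕ k → card (X k) ≡ 1)
  neighbours-of-two-are-single j two
    with a , b , a∈Xj , b∈Xj , a≢b ← length≡2⇒two-distinct (distinct (X j)) two =
    (λ i i⋖j → singleton i (constant⇒length≤1 (a ∩ b) (distinct (X i))
                 (below-two-is-meet a≢b a∈Xj b∈Xj i⋖j))) ,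
    (λ k j⋖k → singleton k (constant⇒length≤1 (a ∪ b) (distinct (X k))
                 (above-two-is-join a≢b a∈Xj b∈Xj j⋖k)))
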